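{- For every integer $k\ge 10$, the path $P_k$ defines the graph $S(2,2)$; that is, there is a coalition partition $\Psi$ of $P_k$ with $\mathrm{CG}(P_k,\Psi)\cong S(2,2)$.
   Context: For a graph $G$ with vertex set $V$, a set $S\subseteq V$ is a dominating set if every vertex of $V\setminus S$ is adjacent to a vertex of $S$. Two disjoint sets $V_1,V_2\subseteq V$ form a coalition in $G$ if neither is a dominating set of $G$ but $V_1\cup V_2$ is. A coalition partition of $G$ is a partition $\Psi=\{V_1,\ldots,V_k\}$ of $V$ such that every $V_i\in\Psi$ is either a dominating set of $G$ with $|V_i|=1$, or is not a dominating set and forms a coalition with some $V_j\in\Psi$. Given a coalition partition $\Psi$ of $G$, the coalition graph $\mathrm{CG}(G,\Psi)$ has vertex set $\Psi$, two members adjacent iff they form a coalition in $G$. $P_k$ is the path on $k$ vertices. $S(2,2)$ is the double star: a tree with exactly two adjacent non-leaf vertices, each having exactly $2$ leaf neighbors. -}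

module Defs where

open import Data.Nat using (ℕ; suc)
open import Data.Fin using (Fin; toℕ; zero; suc)
open import Data.Product using (Σ; ∃; ∃-syntax; _×_; _,_)
open import Data.Sum using (_⊎_)
import Data.Sum
open import Relation.Nullary using (¬_)
open import Relation.Binary.PropositionalEquality using (_≡_; _≢_)
open import Function.Bundles using (_⤖_; Bijection)

record Graph (n : ℕ) : Set₁ where
  field
    Adj   : Fin n → Fin n → Set
    adj-sym   : ∀ {u v} → Adj u v → Adj v u
    adj-irrefl : ∀ {u} → ¬ Adj u u
open Graph public

VSet : ℕ → Set₁
VSet n = Fin n → Set

_∪_ : ∀ {n} → VSet n → VSet n → VSet n
(A ∪ B) v = A v ⊎ B v

Dominating : ∀ {n} → Graph n → VSet n → Set
Dominating G S = ∀ v → S v ⊎ (∃[ u ] (S u × Adj G u v))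

Singleton : ∀ {n} → VSet n → Set
Singleton S = ∃[ v ] (S v × (∀ w → S w → w ≡ v))

Disjoint : ∀ {n} → VSet n → VSet n → Set
Disjoint A B = ∀ v → A v → B v → Data.Empty.⊥
  where import Data.Empty

FormCoalition : ∀ {n} → Graph n → VSet n → VSet n → Set
FormCoalition G A B =
  Disjoint A B × ¬ Dominating G A × ¬ Dominating G B × Dominating G (A ∪ B)

record Partition (n m : ℕ) : Set where
  field
    cls      : Fin n → Fin m
    nonempty : ∀ i → ∃[ v ] (cls v ≡ i)
open Partition public

part : ∀ {n m} → Partition n m → Fin m → VSet n
part Ψ i v = cls Ψ v ≡ i

IsCoalitionPartition : ∀ {n m} → Graph n → Partition n m → Set
IsCoalitionPartition G Ψ = ∀ i →
  (Dominating G (part Ψ i) × Singleton (part Ψ i))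
  ⊎ (¬ Dominating G (part Ψ i) × ∃[ j ] FormCoalition G (part Ψ i) (part Ψ j))

CGAdj : ∀ {n m} → Graph n → Partition n m → Fin m → Fin m → Set
CGAdj G Ψ i j = FormCoalition G (part Ψ i) (part Ψ j)

Isomorphic : ∀ {m m'} → (Fin m → Fin m → Set) → (Fin m' → Fin m' → Set) → Set
Isomorphic {m} {m'} R R' =
  Σ (Fin m ⤖ Fin m') λ φ →
    ∀ i j → (R i j → R' (Bijection.to φ i) (Bijection.to φ j))
          × (R' (Bijection.to φ i) (Bijection.to φ j) → R i j)

PathAdj : ∀ {k} → Fin k → Fin k → Set
PathAdj i j = (toℕ j ≡ suc (toℕ i)) ⊎ (toℕ i ≡ suc (toℕ j))

data S22Edge : Fin 6 → Fin 6 → Set where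
  e01 : S22Edge zero (suc zero)
  e02 : S22Edge zero (suc (suc zero))
  e03 : S22Edge zero (suc (suc (suc zero)))
  e14 : S22Edge (suc zero) (suc (suc (suc (suc zero))))
  e15 : S22Edge (suc zero) (suc (suc (suc (suc (suc zero)))))

S22Adj : Fin 6 → Fin 6 → Set
S22Adj i j = S22Edge i j ⊎ S22Edge j i

private
  open import Data.Nat.Properties using (1+n≢n)
  open import Relation.Binary.PropositionalEquality using (sym)

  pathSym : ∀ {k} {u v : Fin k} → PathAdj u v → PathAdj v u
  pathSym (Data.Sum.inj₁ p) = Data.Sum.inj₂ p
  pathSym (Data.Sum.inj₂ p) = Data.Sum.inj₁ p

  pathIrr : ∀ {k} {u : Fin k} → ¬ PathAdj u u
  pathIrr {u = u} (Data.Sum.inj₁ p) = 1+n≢n (sym p)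
  pathIrr {u = u} (Data.Sum.inj₂ p) = 1+n≢n (sym p)

P : (k : ℕ) → Graph k
P k = record { Adj = PathAdj ; adj-sym = pathSym ; adj-irrefl = pathIrr }

-- Colour the vertices of P_k (k ≥ 10) by  A B a₁ a₂ B A b₁ b₂ A B A B …,  naming the classes after
-- the vertices of S(2,2) they become (A and B are the centres). No class dominates P_k by itself.
-- From vertex 8 on the colours alternate between A and B, so a union of classes containing A or B
-- dominates every vertex from 9 on, and whether a union dominates P_k is decided by the first ten
-- vertices alone. That finite check shows that the dominating unions of two classes are exactly
-- A ∪ B, A ∪ aᵢ and B ∪ bᵢ: the edges of S(2,2).
module Submission where

open import Defs
import Data.Bool as Bool
open import Data.Empty using (⊥; ⊥-elim)
open import Data.Fin using (Fin; toℕ; fromℕ<; inject₁; zero; suc; _≟_)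
open import Data.Fin.Properties using (toℕ<n; toℕ-fromℕ<; toℕ-inject₁; all?; any?)
open import Data.Nat using (ℕ; zero; suc; _+_; _<_; _≤_; _≥_; _<?_; s≤s)
open import Data.Nat.Properties using (≤-trans; m≤m+n; <-trans; <-≤-trans; ≮⇒≥; m≤n⇒∃[o]m+o≡n; allUpTo?; anyUpTo?)
open import Data.Product using (Σ; ∃; ∃-syntax; _×_; _,_)
open import Data.Product.Function.NonDependent.Propositional using (_×-⇔_)
open import Data.Sum using (_⊎_; inj₁; inj₂)
open import Function using (_∘_; const)
open import Function.Bundles using (_⇔_; mk⇔; Equivalence)
open import Function.Construct.Composition using (_⇔-∘_)
open import Function.Construct.Identity using (⤖-id)
open import Function.Related.TypeIsomorphisms using (¬-cong-⇔)
open import Relation.Nullary using (¬_; Dec; yes; no; does; ¬?)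
open import Relation.Nullary.Decidable using (from-yes; _×-dec_; _⊎-dec_)
open import Relation.Unary using (Decidable)
open import Relation.Binary.PropositionalEquality using (_≡_; _≢_; refl; sym; trans; subst; cong)

does≡⇒⇔ : ∀ {a b} {A : Set a} {B : Set b} (a? : Dec A) (b? : Dec B) → does a? ≡ does b? → A ⇔ B
does≡⇒⇔ (yes a) (yes b) _ = mk⇔ (const b) (const a)
does≡⇒⇔ (no ¬a) (no ¬b) _ = mk⇔ (⊥-elim ∘ ¬a) (⊥-elim ∘ ¬b)

disjoint-parts⇔ : ∀ {n m} (Ψ : Partition n m) {i j} → Disjoint (part Ψ i) (part Ψ j) ⇔ i ≢ j
disjoint-parts⇔ Ψ {i} = mk⇔ distinct disjoint
  where
  distinct : ∀ {j} → Disjoint (part Ψ i) (part Ψ j) → i ≢ j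
  distinct disj i≡j with nonempty Ψ i
  ... | v , v∈i = disj v v∈i (trans v∈i i≡j)
  disjoint : ∀ {j} → i ≢ j → Disjoint (part Ψ i) (part Ψ j)
  disjoint i≢j v v∈i v∈j = i≢j (trans (sym v∈i) v∈j)

coalitionPartition-ofNoIsolated : ∀ {n m} {G : Graph n} {Ψ : Partition n m} →
  (∀ i → ∃[ j ] CGAdj G Ψ i j) → IsCoalitionPartition G Ψ
coalitionPartition-ofNoIsolated partner i with partner i
... | j , coalition@(_ , ¬dominating , _) = inj₂ (¬dominating , j , coalition)

s22Edge? : ∀ i j → Dec (S22Edge i j)
s22Edge? zero          zero                                    = no λ ()
s22Edge? zero          (suc zero)                              = yes e01
s22Edge? zero          (suc (suc zero))                        = yes e02
s22Edge? zero          (suc (suc (suc zero)))                  = yes e03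
s22Edge? zero          (suc (suc (suc (suc _))))               = no λ ()
s22Edge? (suc zero)    zero                                    = no λ ()
s22Edge? (suc zero)    (suc zero)                              = no λ ()
s22Edge? (suc zero)    (suc (suc zero))                        = no λ ()
s22Edge? (suc zero)    (suc (suc (suc zero)))                  = no λ ()
s22Edge? (suc zero)    (suc (suc (suc (suc zero))))            = yes e14
s22Edge? (suc zero)    (suc (suc (suc (suc (suc zero)))))      = yes e15
s22Edge? (suc (suc _)) _                                       = no λ ()

s22Adj? : ∀ i j → Dec (S22Adj i j)
s22Adj? i j = s22Edge? i j ⊎-dec s22Edge? j i

s22-noIsolated : ∀ i → ∃[ j ] S22Adj i j
s22-noIsolated = from-yes (all? λ i → any? (s22Adj? i))

AtPred : (ℕ → Set) → ℕ → Set
AtPred Q zero    = ⊥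
AtPred Q (suc n) = Q n

atPred? : ∀ {Q} → Decidable Q → Decidable (AtPred Q)
atPred? Q? zero    = no λ ()
atPred? Q? (suc n) = Q? n

DominatedIn : ℕ → (ℕ → Set) → ℕ → Set
DominatedIn k Q n = Q n ⊎ AtPred Q n ⊎ (suc n < k × Q (suc n))

Near : (ℕ → Set) → ℕ → Set
Near Q n = Q n ⊎ AtPred Q n ⊎ Q (suc n)

near? : ∀ {Q} → Decidable Q → Decidable (Near Q)
near? Q? n = Q? n ⊎-dec atPred? Q? n ⊎-dec Q? (suc n)

dominatedIn⇒near : ∀ {k Q n} → DominatedIn k Q n → Near Q n
dominatedIn⇒near (inj₁ q)             = inj₁ q
dominatedIn⇒near (inj₂ (inj₁ q))      = inj₂ (inj₁ q)
dominatedIn⇒near (inj₂ (inj₂ (_ , q))) = inj₂ (inj₂ q)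

near⇒dominatedIn : ∀ {k Q n} → suc n < k → Near Q n → DominatedIn k Q n
near⇒dominatedIn _    (inj₁ q)        = inj₁ q
near⇒dominatedIn _    (inj₂ (inj₁ q)) = inj₂ (inj₁ q)
near⇒dominatedIn n<k (inj₂ (inj₂ q)) = inj₂ (inj₂ (n<k , q))

dominating-path⇔ : ∀ {k} (Q : ℕ → Set) →
  Dominating (P k) (Q ∘ toℕ) ⇔ (∀ {n} → n < k → DominatedIn k Q n)
dominating-path⇔ {k} Q = mk⇔ dominated dominating
  where
  dominatedVertex : Dominating (P k) (Q ∘ toℕ) → ∀ v → DominatedIn k Q (toℕ v)
  dominatedVertex d v with d v
  ... | inj₁ q                   = inj₁ q
  ... | inj₂ (u , q , inj₁ v≡1+u) = inj₂ (inj₁ (subst (AtPred Q) (sym v≡1+u) q))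
  ... | inj₂ (u , q , inj₂ u≡1+v) = inj₂ (inj₂ (subst (_< k) u≡1+v (toℕ<n u) , subst Q u≡1+v q))

  dominated : Dominating (P k) (Q ∘ toℕ) → ∀ {n} → n < k → DominatedIn k Q n
  dominated d n<k = subst (DominatedIn k Q) (toℕ-fromℕ< n<k) (dominatedVertex d (fromℕ< n<k))

  predecessor : ∀ {k} (v : Fin k) → AtPred Q (toℕ v) → ∃[ u ] Q (toℕ u) × PathAdj u v
  predecessor (suc u) q =
    inject₁ u , subst Q (sym (toℕ-inject₁ u)) q , inj₁ (cong suc (sym (toℕ-inject₁ u)))

  dominating : (∀ {n} → n < k → DominatedIn k Q n) → Dominating (P k) (Q ∘ toℕ)
  dominating h v with h (toℕ<n v)
  ... | inj₁ q               = inj₁ q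
  ... | inj₂ (inj₁ q)        = inj₂ (predecessor v q)
  ... | inj₂ (inj₂ (lt , q)) =
    inj₂ (fromℕ< lt , subst Q (sym (toℕ-fromℕ< lt)) q , inj₂ (toℕ-fromℕ< lt))

A B a₁ a₂ b₁ b₂ : Fin 6
A  = zero
B  = suc zero
a₁ = suc (suc zero)
a₂ = suc (suc (suc zero))
b₁ = suc (suc (suc (suc zero)))
b₂ = suc (suc (suc (suc (suc zero))))

alternating : ℕ → Fin 6
alternating zero          = A
alternating (suc zero)    = B
alternating (suc (suc n)) = alternating n

colour : ℕ → Fin 6
colour 0 = A
colour 1 = B
colour 2 = a₁
colour 3 = a₂
colour 4 = B
colour 5 = A
colour 6 = b₁
colour 7 = b₂
colour (suc (suc (suc (suc (suc (suc (suc (suc n)))))))) = alternating n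

colouring : ∀ {k} → 8 ≤ k → Partition k 6
colouring {k} k≥8 = record { cls = colour ∘ toℕ ; nonempty = witness }
  where
  firstOccurrence : ∀ i → ∃[ n ] n < 8 × colour n ≡ i
  firstOccurrence = from-yes (all? λ i → anyUpTo? (λ n → colour n ≟ i) 8)

  witness : ∀ i → ∃[ v ] colour (toℕ v) ≡ i
  witness i with firstOccurrence i
  ... | n , n<8 , refl = fromℕ< n<k , cong colour (toℕ-fromℕ< n<k)
    where
    n<k : n < k
    n<k = <-≤-trans n<8 k≥8

alternating-near : ∀ {C : Fin 6 → Set} → C A ⊎ C B →
  ∀ n → C (alternating (suc n)) ⊎ C (alternating n)
alternating-near (inj₁ cA) zero          = inj₂ cA
alternating-near (inj₂ cB) zero          = inj₁ cB
alternating-near (inj₁ cA) (suc zero)    = inj₁ cA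
alternating-near (inj₂ cB) (suc zero)    = inj₂ cB
alternating-near {C} c    (suc (suc n)) = alternating-near {C} c n

-- Vertices 0–8 have their whole neighbourhood among the first ten vertices; vertex 9 and the
-- alternating tail are dominated exactly when A or B is among the colours C.
PrefixCondition : (Fin 6 → Set) → Set
PrefixCondition C = (∀ {n} → n < 9 → Near (C ∘ colour) n) × (C A ⊎ C B)

prefixCondition? : ∀ {C} → Decidable C → Dec (PrefixCondition C)
prefixCondition? C? = allUpTo? (near? (C? ∘ colour)) 9 ×-dec (C? A ⊎-dec C? B)

dominating-colours⇔ : ∀ {k} → 10 ≤ k → (C : Fin 6 → Set) →
  Dominating (P k) (C ∘ colour ∘ toℕ) ⇔ PrefixCondition C
dominating-colours⇔ {k} k≥10 C =
  mk⇔ (prefixCondition ∘ Equivalence.to path⇔) (Equivalence.from path⇔ ∘ dominated)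
  where
  path⇔ : Dominating (P k) (C ∘ colour ∘ toℕ) ⇔ (∀ {n} → n < k → DominatedIn k (C ∘ colour) n)
  path⇔ = dominating-path⇔ {k} (C ∘ colour)

  prefixCondition : (∀ {n} → n < k → DominatedIn k (C ∘ colour) n) → PrefixCondition C
  prefixCondition h = (λ n<9 → dominatedIn⇒near (h (<-trans n<9 k≥10))) , atVertex9 (h k≥10)
    where
    atVertex9 : DominatedIn k (C ∘ colour) 9 → C A ⊎ C B
    atVertex9 (inj₁ cB)             = inj₂ cB
    atVertex9 (inj₂ (inj₁ cA))      = inj₁ cA
    atVertex9 (inj₂ (inj₂ (_ , cA))) = inj₁ cA

  tail : C A ⊎ C B → ∀ t → DominatedIn k (C ∘ colour) (9 + t)
  tail c t with alternating-near {C} c t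
  ... | inj₁ here  = inj₁ here
  ... | inj₂ there = inj₂ (inj₁ there)

  dominated : PrefixCondition C → ∀ {n} → n < k → DominatedIn k (C ∘ colour) n
  dominated (prefix , c) {n} _ with n <? 9
  ... | yes n<9 = near⇒dominatedIn (<-≤-trans (s≤s n<9) k≥10) (prefix n<9)
  ... | no n≮9 with m≤n⇒∃[o]m+o≡n (≮⇒≥ n≮9)
  ...   | t , refl = tail c t

ColourCoalition : Fin 6 → Fin 6 → Set
ColourCoalition i j =
  i ≢ j × ¬ PrefixCondition (_≡ i) × ¬ PrefixCondition (_≡ j)
  × PrefixCondition (λ x → x ≡ i ⊎ x ≡ j)

colourCoalition? : ∀ i j → Dec (ColourCoalition i j)
colourCoalition? i j =
  ¬? (i ≟ j) ×-dec ¬? (prefixCondition? (_≟ i)) ×-dec ¬? (prefixCondition? (_≟ j))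
  ×-dec prefixCondition? (λ x → (x ≟ i) ⊎-dec (x ≟ j))

module _ {k} (k≥10 : 10 ≤ k) where

  colourPartition : Partition k 6
  colourPartition = colouring (≤-trans (m≤m+n 8 2) k≥10)

  cgAdj⇔colourCoalition : ∀ i j → CGAdj (P k) colourPartition i j ⇔ ColourCoalition i j
  cgAdj⇔colourCoalition i j =
    disjoint-parts⇔ colourPartition
    ×-⇔ ¬-cong-⇔ (dominating-colours⇔ k≥10 (_≡ i))
    ×-⇔ ¬-cong-⇔ (dominating-colours⇔ k≥10 (_≡ j))
    ×-⇔ dominating-colours⇔ k≥10 (λ x → x ≡ i ⊎ x ≡ j)

colourCoalition⇔s22Adj : ∀ i j → ColourCoalition i j ⇔ S22Adj i j
colourCoalition⇔s22Adj i j = does≡⇒⇔ (colourCoalition? i j) (s22Adj? i j) (sameAnswer i j)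
  where
  sameAnswer : ∀ i j → does (colourCoalition? i j) ≡ does (s22Adj? i j)
  sameAnswer = from-yes (all? λ i → all? λ j → does (colourCoalition? i j) Bool.≟ does (s22Adj? i j))

proposition11 : (k : ℕ) → k ≥ 10 →
    ∃[ m ] Σ (Partition k m) λ Ψ →
      IsCoalitionPartition (P k) Ψ × Isomorphic (CGAdj (P k) Ψ) S22Adj
proposition11 k k≥10 =
  6 , colourPartition k≥10 , coalitionPartition-ofNoIsolated {G = P k} {Ψ = colourPartition k≥10} partner
    , ⤖-id (Fin 6) , λ i j → to (iso i j) , from (iso i j)
  where
  open Equivalence using (to; from)

  iso : ∀ i j → CGAdj (P k) (colourPartition k≥10) i j ⇔ S22Adj i j
  iso i j = colourCoalition⇔s22Adj i j ⇔-∘ cgAdj⇔colourCoalition k≥10 i j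

  partner : ∀ i → ∃[ j ] CGAdj (P k) (colourPartition k≥10) i j
  partner i with s22-noIsolated i
  ... | j , edge = j , from (iso i j) edge
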